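{- Let $s\in\Sigma^n$ and $1\le i\le n$. If $\mathcal{L}\beta(s)[i]=x$ with $x\ge1$, then $\mathcal{L}\beta(s)[x]=0$.
   Context: $\Sigma$ is a finite totally ordered alphabet. A border of a string $w$ is a string that is both a prefix and a suffix of $w$ and differs from $w$. A Lyndon word is a nonempty string strictly lexicographically smaller than each of its nonempty proper suffixes. For $1\le i\le n$, $\mathcal{L}\beta(s)[i]$ is the length of the longest border of $s[1..i]$ which is a Lyndon word ($0$ if none). -}

module Defs where

open import Data.Nat using (ℕ; zero; suc; _<_; _≤_)
open import Data.Fin using (Fin)
import Data.Fin as F
open import Data.List using (List; []; _∷_; length; take; drop; _++_)
open import Data.List.Relation.Binary.Lex.Strict using (Lex-<)
open import Data.Product using (Σ; ∃; _×_; _,_)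
open import Data.Sum using (_⊎_)
open import Data.Empty using (⊥)
open import Relation.Binary.PropositionalEquality using (_≡_)

-- The alphabet: a finite totally ordered alphabet of size σ is (up to
-- order-isomorphism) Fin σ with its usual strict order.
Letter : ℕ → Set
Letter σ = Fin σ

Word : ℕ → Set
Word σ = List (Letter σ)

-- Strict lexicographic order (a proper prefix is smaller).
_≺_ : ∀ {σ} → Word σ → Word σ → Set
_≺_ = Lex-< _≡_ F._<_

IsPrefix : ∀ {σ} → Word σ → Word σ → Set
IsPrefix u w = Σ _ λ v → u ++ v ≡ w

IsSuffix : ∀ {σ} → Word σ → Word σ → Set
IsSuffix u w = Σ _ λ v → v ++ u ≡ w

-- u is a border of w: prefix and suffix of w, different from w
-- (equivalently, given prefix-hood, strictly shorter than w).
IsBorder : ∀ {σ} → Word σ → Word σ → Set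
IsBorder u w = IsPrefix u w × IsSuffix u w × (length u < length w)

IsLyndon : ∀ {σ} → Word σ → Set
IsLyndon w = (0 < length w) ×
  (∀ j → 1 ≤ j → j < length w → w ≺ drop j w)

prefixOf : ∀ {σ} → ℕ → Word σ → Word σ
prefixOf i s = take i s

-- LBeta s i x : "Lβ(s)[i] = x", i.e. x is the length of the longest border
-- of s[1..i] that is a Lyndon word, or 0 if there is none.
LBeta : ∀ {σ} → Word σ → ℕ → ℕ → Set
LBeta s i x =
  ((x ≡ 0) × (∀ u → IsBorder u (prefixOf i s) → IsLyndon u → ⊥))
  ⊎ (Σ _ λ u → IsBorder u (prefixOf i s) × IsLyndon u × (length u ≡ x)
       × (∀ v → IsBorder v (prefixOf i s) → IsLyndon v → length v ≤ x))

module Submission where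

-- A Lyndon word is unbordered: if v were a nonempty border of a
-- Lyndon word u = w' ++ v = v ++ w, then v is a nonempty proper suffix of u,
-- so u ≺ v, i.e. v ++ w ≺ v; but no word is lexicographically smaller than
-- its own prefix.
--
-- Now let x = Lβ(s)[i] ≥ 1 be witnessed by a Lyndon border u of s[1..i].
-- Being a prefix of s[1..i], u is a prefix of s, so s[1..x] = u.  Every
-- Lyndon border of s[1..x] would then be a nonempty border of the Lyndon
-- word u, which is impossible; hence Lβ(s)[x] = 0.

open import Defs
open import Data.Nat using (ℕ; _≤_; _≥_; _<_; _+_)
open import Data.Nat.Properties using (<-irrefl; n≢0⇒n>0; m<m+n)
open import Data.List using (List; []; _∷_; length; take; drop; _++_)
open import Data.List.Properties using (length-++; ++-assoc; take++drop≡id)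
open import Data.List.Relation.Binary.Lex.Strict using (Lex-<; base; this; next)
open import Data.Fin.Properties using () renaming (<-irrefl to Fin-<-irrefl)
open import Data.Product using (_,_)
open import Data.Sum using (inj₁; inj₂)
open import Data.Empty using (⊥)
open import Relation.Binary.Definitions using (Irreflexive)
open import Relation.Binary.PropositionalEquality
  using (_≡_; refl; sym; trans; cong; subst; subst₂)

take-length-++ : ∀ {A : Set} (u w : List A) → take (length u) (u ++ w) ≡ u
take-length-++ []      w = refl
take-length-++ (a ∷ u) w = cong (a ∷_) (take-length-++ u w)

drop-length-++ : ∀ {A : Set} (u w : List A) → drop (length u) (u ++ w) ≡ w
drop-length-++ []      w = refl
drop-length-++ (a ∷ u) w = drop-length-++ u w

prefix⇒take : ∀ {σ} {u w : Word σ} → IsPrefix u w → take (length u) w ≡ u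
prefix⇒take {u = u} (v , refl) = take-length-++ u v

prefix-trans : ∀ {σ} {u v w : Word σ} → IsPrefix u v → IsPrefix v w → IsPrefix u w
prefix-trans {u = u} (a , refl) (b , refl) = a ++ b , sym (++-assoc u a b)

take-prefix : ∀ {σ} (i : ℕ) (s : Word σ) → IsPrefix (take i s) s
take-prefix i s = drop i s , take++drop≡id i s

extension-not-smaller : ∀ {A : Set} {_<_ : A → A → Set} → Irreflexive _≡_ _<_ →
                        (v w : List A) → Lex-< _≡_ _<_ (v ++ w) v → ⊥
extension-not-smaller irr []      []      (base ())
extension-not-smaller irr (a ∷ v) w       (this a<a)  = irr refl a<a
extension-not-smaller irr (a ∷ v) w       (next _ lt) = extension-not-smaller irr v w lt

lyndon-unbordered : ∀ {σ} {u v : Word σ} → IsLyndon u → IsBorder v u → 0 < length v → ⊥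
lyndon-unbordered {u = u} {v} (_ , smaller-than-suffixes)
                  ((w , v++w≡u) , (w' , w'++v≡u) , |v|<|u|) 0<|v| =
  extension-not-smaller Fin-<-irrefl v w v++w≺v
  where
  |u|≡|w'|+|v| : length u ≡ length w' + length v
  |u|≡|w'|+|v| = trans (cong length (sym w'++v≡u)) (length-++ w')

  drop-w' : drop (length w') u ≡ v
  drop-w' = trans (cong (drop (length w')) (sym w'++v≡u)) (drop-length-++ w' v)

  -- the suffix is proper since v is shorter than u ...
  0<|w'| : 0 < length w'
  0<|w'| = n≢0⇒n>0 λ |w'|≡0 → <-irrefl (sym (trans |u|≡|w'|+|v| (cong (_+ length v) |w'|≡0))) |v|<|u|

  -- ... and nonempty since v is
  |w'|<|u| : length w' < length u
  |w'|<|u| = subst (length w' <_) (sym |u|≡|w'|+|v|) (m<m+n (length w') 0<|v|)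

  v++w≺v : (v ++ w) ≺ v
  v++w≺v = subst₂ _≺_ (sym v++w≡u) drop-w' (smaller-than-suffixes (length w') 0<|w'| |w'|<|u|)

lyndon-prefix⇒LBeta-0 : ∀ {σ} {u s : Word σ} → IsLyndon u → IsPrefix u s → LBeta s (length u) 0
lyndon-prefix⇒LBeta-0 u-lyndon u-prefix =
  inj₁ (refl , λ v v-border (0<|v| , _) →
    lyndon-unbordered u-lyndon (subst (IsBorder v) (prefix⇒take u-prefix) v-border) 0<|v|)

fact3 : ∀ (σ n : ℕ) (s : Word σ) → length s ≡ n →
        ∀ (i x : ℕ) → 1 ≤ i → i ≤ n →
        LBeta s i x → x ≥ 1 → LBeta s x 0
-- Lβ(s)[i] = 0 contradicts x ≥ 1.
fact3 σ n s _ i x _ _ (inj₁ (refl , _)) ()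
fact3 σ n s _ i x _ _ (inj₂ (u , (u-prefix , _ , _) , u-lyndon , refl , _)) _ =
  lyndon-prefix⇒LBeta-0 u-lyndon (prefix-trans u-prefix (take-prefix i s))
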